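{- Let $L\subseteq\prod_{i}C_i$ be a subdirect product of totally ordered BL-algebras $C_i$, with projections $\pi_i:\prod_iC_i\to C_i$. For a sequence $\mathbf{a}=(a_1,a_2,\ldots)$ in $L$ let $\mathbf{a}_i=(\pi_i(a_1),\pi_i(a_2),\ldots)$, a sequence in $C_i$. Then: 1. $\mathbf{a}$ is a good sequence in $L$ if and only if every $\mathbf{a}_i$ is a good sequence in $C_i$ and there is $m\ge0$ such that $\pi_i(a_n)=0$ for all $n>m$ and all $i$. 2. For good sequences $\mathbf{a},\mathbf{b}$ in $L$, $\mathbf{a}+\mathbf{b}$ is a good sequence in $L$ if and only if for every $i$, $\mathbf{a}_i+\mathbf{b}_i$ is a good sequence in $C_i$.
   Context: A BL-algebra is an algebra $(L,\wedge,\vee,\otimes,\to,0,1)$ such that $(L,\wedge,\vee,0,1)$ is a bounded lattice, $(L,\otimes,1)$ is a commutative monoid, $x\otimes y\le z$ iff $x\le y\to z$, $x\wedge y=x\otimes(x\to y)$, and $(x\to y)\vee(y\to x)=1$. A subdirect product is a subalgebra $L$ of the product $\prod_iC_i$ such that each restricted projection $\pi_i|_L$ is surjective. Put $\bar x=x\to0$, $x\oslash y=\bar x\to y$, $x+y=(x\oslash y)\wedge(y\oslash x)$. A good sequence is a sequence $(a_1,a_2,\ldots)$ with $a_i+a_{i+1}=a_i$ for all $i$ and $a_r=0$ for all large $r$. The sum of sequences is $\mathbf{a}+\mathbf{b}=(c_i)$ with $c_i=a_i+(a_{i-1}\otimes b_1)+\cdots+(a_1\otimes b_{i-1})+b_i$.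 -}

module Defs where

open import Level using (Level; _⊔_; suc)
open import Data.Nat using (ℕ; zero; _∸_; _≤_) renaming (suc to sucℕ)
open import Data.List using (List; []; _∷_; map; upTo; foldl; _++_; [_])
open import Data.Product using (Σ; ∃; _×_; _,_; proj₁; proj₂)
open import Data.Sum using (_⊎_)
open import Relation.Binary.Core using (Rel)
open import Relation.Binary.Structures using (IsEquivalence)
open import Algebra.Core using (Op₂)
open import Algebra.Structures using (IsCommutativeMonoid)
open import Algebra.Lattice.Structures using (IsLattice)

record BLOps (c ℓ : Level) : Set (suc (c ⊔ ℓ)) where
  infix  4 _≈_
  infixr 7 _⊓_
  infixr 6 _⊔ᴮ_
  infixr 7 _⊗_
  infixr 5 _⇒_
  field
    Carrier : Set c
    _≈_     : Rel Carrier ℓ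
    _⊓_     : Op₂ Carrier
    _⊔ᴮ_    : Op₂ Carrier
    _⊗_     : Op₂ Carrier
    _⇒_     : Op₂ Carrier
    𝟎       : Carrier
    𝟏       : Carrier

  _≤ᴮ_ : Rel Carrier ℓ
  x ≤ᴮ y = (x ⊓ y) ≈ x

  neg : Carrier → Carrier
  neg x = x ⇒ 𝟎

  _⊘_ : Op₂ Carrier
  x ⊘ y = neg x ⇒ y

  _⊕_ : Op₂ Carrier
  x ⊕ y = (x ⊘ y) ⊓ (y ⊘ x)

  -- Sequences are indexed from 0: (a 0 , a 1 , …) stands for (a₁ , a₂ , …).
  -- Good sequence: a_i + a_{i+1} = a_i for all i, and a_r = 0 for all large r.
  Good : (ℕ → Carrier) → Set ℓ
  Good a = (∀ n → (a n ⊕ a (sucℕ n)) ≈ a n)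
         × ∃ λ r → ∀ n → r ≤ n → a n ≈ 𝟎

  -- Sum of sequences:
  -- c_i = a_i + (a_{i-1} ⊗ b_1) + ⋯ + (a_1 ⊗ b_{i-1}) + b_i
  -- (0-indexed, the + being associated to the left).
  _+ₛ_ : (ℕ → Carrier) → (ℕ → Carrier) → (ℕ → Carrier)
  (a +ₛ b) n =
    foldl _⊕_ (a n) (map (λ k → a (n ∸ sucℕ k) ⊗ b k) (upTo n) ++ [ b n ])

record BLAlgebra (c ℓ : Level) : Set (suc (c ⊔ ℓ)) where
  field
    ops : BLOps c ℓ
  open BLOps ops public
  field
    isEquivalence : IsEquivalence _≈_
    isLattice     : IsLattice _≈_ _⊔ᴮ_ _⊓_
    ⊗-isCommutativeMonoid : IsCommutativeMonoid _≈_ _⊗_ 𝟏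
    ⇒-cong        : ∀ {x y u v} → x ≈ y → u ≈ v → (x ⇒ u) ≈ (y ⇒ v)
    𝟎-least       : ∀ x → 𝟎 ≤ᴮ x
    𝟏-greatest    : ∀ x → x ≤ᴮ 𝟏
    residuation₁  : ∀ x y z → (x ⊗ y) ≤ᴮ z → x ≤ᴮ (y ⇒ z)
    residuation₂  : ∀ x y z → x ≤ᴮ (y ⇒ z) → (x ⊗ y) ≤ᴮ z
    divisibility  : ∀ x y → (x ⊓ y) ≈ (x ⊗ (x ⇒ y))
    prelinearity  : ∀ x y → ((x ⇒ y) ⊔ᴮ (y ⇒ x)) ≈ 𝟏

IsChain : ∀ {c ℓ} → BLAlgebra c ℓ → Set (c ⊔ ℓ)
IsChain C = ∀ x y → (x ≤ᴮ y) ⊎ (y ≤ᴮ x)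
  where open BLAlgebra C

module _ {i c ℓ : Level} {I : Set i} (C : I → BLAlgebra c ℓ) where
  private module C (j : I) = BLAlgebra (C j)

  Π : Set (i ⊔ c)
  Π = (j : I) → C.Carrier j

  record IsSubdirectProduct {p} (P : Π → Set p) : Set (i ⊔ c ⊔ ℓ ⊔ p) where
    field
      ⊓-closed : ∀ {x y} → P x → P y → P (λ j → C._⊓_ j (x j) (y j))
      ⊔-closed : ∀ {x y} → P x → P y → P (λ j → C._⊔ᴮ_ j (x j) (y j))
      ⊗-closed : ∀ {x y} → P x → P y → P (λ j → C._⊗_ j (x j) (y j))
      ⇒-closed : ∀ {x y} → P x → P y → P (λ j → C._⇒_ j (x j) (y j))
      𝟎-closed : P (λ j → C.𝟎 j)
      𝟏-closed : P (λ j → C.𝟏 j)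
      π-surjective : ∀ j (z : C.Carrier j) → Σ Π λ x → P x × C._≈_ j (x j) z

  subOps : ∀ {p} (P : Π → Set p) → IsSubdirectProduct P → BLOps (i ⊔ c ⊔ p) (i ⊔ ℓ)
  subOps P S = record
    { Carrier = Σ Π P
    ; _≈_ = λ x y → ∀ j → C._≈_ j (proj₁ x j) (proj₁ y j)
    ; _⊓_ = λ x y → (λ j → C._⊓_ j (proj₁ x j) (proj₁ y j)) , ⊓-closed (proj₂ x) (proj₂ y)
    ; _⊔ᴮ_ = λ x y → (λ j → C._⊔ᴮ_ j (proj₁ x j) (proj₁ y j)) , ⊔-closed (proj₂ x) (proj₂ y)
    ; _⊗_ = λ x y → (λ j → C._⊗_ j (proj₁ x j) (proj₁ y j)) , ⊗-closed (proj₂ x) (proj₂ y)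
    ; _⇒_ = λ x y → (λ j → C._⇒_ j (proj₁ x j) (proj₁ y j)) , ⇒-closed (proj₂ x) (proj₂ y)
    ; 𝟎 = (λ j → C.𝟎 j) , 𝟎-closed
    ; 𝟏 = (λ j → C.𝟏 j) , 𝟏-closed
    }
    where open IsSubdirectProduct S

module Submission where

-- The subdirect product L carries the pointwise operations and
-- the pointwise equality of ∏ C_i, so "a_n ⊕ a_{n+1} ≈ a_n in L" is literally
-- "for every i, π_i(a_n) ⊕ π_i(a_{n+1}) ≈ π_i(a_n) in C_i", and "a_n ≈ 0 from
-- r on" is literally a bound r working for all components at once.  This
-- gives part 1 (`good-iff-componentwise`) by merely regrouping quantifiers.
--
-- For part 2 we show that the projections π_i commute with the sum of
-- sequences (`π-+ₛ`, via the fold fusion law `foldl-homomorphism`), and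
-- apply part 1 to a + b.  The only non-formal ingredient is the uniform
-- bound: in any BL-algebra, if a vanishes from r_a on and b from r_b on,
-- then a + b vanishes from r_a + r_b on (`+ₛ-eventually-zero`), because
-- every summand a_{n-k-1} ⊗ b_k has a vanishing factor and 0 + 0 = 0.
-- The bounds r_a, r_b of the good sequences a, b in L serve for all i.

open import Defs
open import Level using (Level)
open import Data.Nat using (ℕ; _≤_; _<_; _+_; _∸_) renaming (suc to sucℕ)
open import Data.Nat.Properties
  using (≤-trans; +-monoʳ-≤; m+n≤o⇒m≤o∸n; m≤m+n; m≤n+m; ≰⇒>; _≤?_)
open import Data.Product using (∃; _×_; _,_; proj₁)
open import Data.List using ([]; _∷_; map; upTo; foldl; _++_; [_])
open import Data.List.Properties using (map-++; map-∘)
open import Data.List.Relation.Unary.All using (All; []; _∷_)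
open import Data.List.Relation.Unary.All.Properties using (map⁺; ++⁺; applyUpTo⁺₁)
open import Relation.Binary.PropositionalEquality
  using (_≡_; refl; sym; trans; cong; subst; module ≡-Reasoning)
open import Relation.Nullary using (yes; no)
open import Function.Bundles using (_⇔_; mk⇔; module Equivalence)
open import Algebra.Lattice.Structures using (IsLattice)
open import Algebra.Structures using (IsCommutativeMonoid)
open import Relation.Binary.Structures using (IsEquivalence)

foldl-homomorphism : ∀ {a b} {A : Set a} {B : Set b}
  (h : A → B) (f : A → A → A) (g : B → B → B)
  → (∀ x y → h (f x y) ≡ g (h x) (h y))
  → ∀ x xs → h (foldl f x xs) ≡ foldl g (h x) (map h xs)
foldl-homomorphism h f g hom x []       = refl
foldl-homomorphism h f g hom x (y ∷ ys) =
  trans (foldl-homomorphism h f g hom (f x y) ys)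
        (cong (λ z → foldl g z (map h ys)) (hom x y))

module _ {c ℓ} (B : BLOps c ℓ) where
  open BLOps B

  Good-resp-≗ : ∀ {a b : ℕ → Carrier} → (∀ n → a n ≡ b n) → Good a → Good b
  Good-resp-≗ {a} {b} a≗b (step , r , vanish) =
    (λ n → transport-step n (step n)) , r , λ n r≤n → subst (_≈ 𝟎) (a≗b n) (vanish n r≤n)
    where
      transport-step : ∀ n → (a n ⊕ a (sucℕ n)) ≈ a n → (b n ⊕ b (sucℕ n)) ≈ b n
      transport-step n e rewrite a≗b n | a≗b (sucℕ n) = e

module ZeroFacts {c ℓ} (B : BLAlgebra c ℓ) where
  open BLAlgebra B
  private
    module ≈ = IsEquivalence isEquivalence
    module Lat = IsLattice isLattice
    module Mon = IsCommutativeMonoid ⊗-isCommutativeMonoid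

  ⊓-idem : ∀ x → (x ⊓ x) ≈ x
  ⊓-idem x = ≈.trans (Lat.∧-cong ≈.refl (≈.sym (Lat.∨-absorbs-∧ x x)))
                     (Lat.∧-absorbs-∨ x (x ⊓ x))

  ≤-antisym : ∀ {x y} → x ≤ᴮ y → y ≤ᴮ x → x ≈ y
  ≤-antisym x≤y y≤x = ≈.trans (≈.sym x≤y) (≈.trans (Lat.∧-comm _ _) y≤x)

  ≤-respˡ-≈ : ∀ {x x′ y} → x ≈ x′ → x ≤ᴮ y → x′ ≤ᴮ y
  ≤-respˡ-≈ e x≤y = ≈.trans (Lat.∧-cong (≈.sym e) ≈.refl) (≈.trans x≤y e)

  -- 0 is absorbing for ⊗: x ⊗ 0 ≤ 0 by residuation from 0 ≤ x → 0.
  ⊗-zeroʳ : ∀ x → (x ⊗ 𝟎) ≈ 𝟎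
  ⊗-zeroʳ x = ≤-antisym (≤-respˡ-≈ (Mon.comm 𝟎 x) (residuation₂ 𝟎 x 𝟎 (𝟎-least _)))
                        (𝟎-least _)

  ⊗-zeroˡ : ∀ x → (𝟎 ⊗ x) ≈ 𝟎
  ⊗-zeroˡ x = ≈.trans (Mon.comm 𝟎 x) (⊗-zeroʳ x)

  neg-𝟎 : neg 𝟎 ≈ 𝟏
  neg-𝟎 = ≤-antisym (𝟏-greatest _)
    (residuation₁ 𝟏 𝟎 𝟎 (≤-respˡ-≈ (≈.sym (⊗-zeroʳ 𝟏)) (⊓-idem 𝟎)))

  neg-𝟏 : neg 𝟏 ≈ 𝟎
  neg-𝟏 = ≤-antisym (≤-respˡ-≈ (Mon.identityʳ _) (residuation₂ (neg 𝟏) 𝟏 𝟎 (⊓-idem _)))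
                    (𝟎-least _)

  -- 0 + 0 = 0, since 0 ⊘ 0 = 0̄ → 0 = 1 → 0 = 0.
  ⊕-zero : ∀ {x y} → x ≈ 𝟎 → y ≈ 𝟎 → (x ⊕ y) ≈ 𝟎
  ⊕-zero x≈0 y≈0 = ≈.trans (Lat.∧-cong (⊘-zero x≈0 y≈0) (⊘-zero y≈0 x≈0)) (⊓-idem 𝟎)
    where
      ⊘-zero : ∀ {x y} → x ≈ 𝟎 → y ≈ 𝟎 → (x ⊘ y) ≈ 𝟎
      ⊘-zero x≈0 y≈0 = ≈.trans (⇒-cong (≈.trans (⇒-cong x≈0 ≈.refl) neg-𝟎) y≈0) neg-𝟏

  foldl-⊕-zero : ∀ {x} xs → x ≈ 𝟎 → All (_≈ 𝟎) xs → foldl _⊕_ x xs ≈ 𝟎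
  foldl-⊕-zero []       x≈0 []           = x≈0
  foldl-⊕-zero (y ∷ ys) x≈0 (y≈0 ∷ ys≈0) = foldl-⊕-zero ys (⊕-zero x≈0 y≈0) ys≈0

  -- If a vanishes from rₐ on and b from r_b on, then a + b vanishes from
  -- rₐ + r_b on: in every cross term a_{n-k-1} ⊗ b_k one factor vanishes.
  +ₛ-eventually-zero : ∀ (a b : ℕ → Carrier) {rₐ r_b}
    → (∀ n → rₐ ≤ n → a n ≈ 𝟎) → (∀ n → r_b ≤ n → b n ≈ 𝟎)
    → ∀ n → rₐ + r_b ≤ n → (a +ₛ b) n ≈ 𝟎
  +ₛ-eventually-zero a b {rₐ} {r_b} a-vanish b-vanish n bound =
    foldl-⊕-zero _ (a-vanish n (≤-trans (m≤m+n rₐ r_b) bound))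
      (++⁺ (map⁺ (applyUpTo⁺₁ _ n cross-term-zero))
           (b-vanish n (≤-trans (m≤n+m r_b rₐ) bound) ∷ []))
    where
      cross-term-zero : ∀ {k} → k < n → (a (n ∸ sucℕ k) ⊗ b k) ≈ 𝟎
      cross-term-zero {k} k<n with r_b ≤? k
      ... | yes r_b≤k = ≈.trans (Mon.∙-cong ≈.refl (b-vanish k r_b≤k)) (⊗-zeroʳ _)
      ... | no  r_b≰k = ≈.trans (Mon.∙-cong (a-vanish (n ∸ sucℕ k) rₐ≤n-k-1) ≈.refl)
                                (⊗-zeroˡ _)
        where
          rₐ≤n-k-1 : rₐ ≤ n ∸ sucℕ k
          rₐ≤n-k-1 = m+n≤o⇒m≤o∸n rₐ (≤-trans (+-monoʳ-≤ rₐ (≰⇒> r_b≰k)) bound)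

module SubdirectSequences {i c ℓ p : Level} {I : Set i} (C : I → BLAlgebra c ℓ)
                          (P : Π C → Set p) (S : IsSubdirectProduct C P) where
  module L = BLOps (subOps C P S)
  module Cj (j : I) = BLAlgebra (C j)

  π : (j : I) → L.Carrier → Cj.Carrier j
  π j x = proj₁ x j

  proj : (j : I) → (ℕ → L.Carrier) → ℕ → Cj.Carrier j
  proj j a n = π j (a n)

  -- Part 1: goodness in L is componentwise goodness plus a uniform bound;
  -- both sides are the same data with the quantifiers regrouped.
  good-iff-componentwise : (a : ℕ → L.Carrier)
    → L.Good a
      ⇔ ((∀ j → Cj.Good j (proj j a))
         × ∃ λ m → ∀ n → m ≤ n → ∀ j → Cj._≈_ j (proj j a n) (Cj.𝟎 j))
  good-iff-componentwise a = mk⇔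
    (λ { (step , r , vanish) →
           (λ j → (λ n → step n j) , r , λ n r≤n → vanish n r≤n j) , r , vanish })
    (λ { (good , m , vanish) → (λ n j → proj₁ (good j) n) , m , vanish })

  π-+ₛ : ∀ j (a b : ℕ → L.Carrier) n
    → π j ((a L.+ₛ b) n) ≡ Cj._+ₛ_ j (proj j a) (proj j b) n
  π-+ₛ j a b n = begin
    π j (foldl L._⊕_ (a n) (terms ++ [ b n ]))
      ≡⟨ foldl-homomorphism (π j) L._⊕_ (Cj._⊕_ j) (λ _ _ → refl) (a n) (terms ++ [ b n ]) ⟩
    foldl (Cj._⊕_ j) (proj j a n) (map (π j) (terms ++ [ b n ]))
      ≡⟨ cong (foldl (Cj._⊕_ j) (proj j a n)) (map-++ (π j) terms [ b n ]) ⟩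
    foldl (Cj._⊕_ j) (proj j a n) (map (π j) terms ++ [ proj j b n ])
      ≡⟨ cong (λ ts → foldl (Cj._⊕_ j) (proj j a n) (ts ++ [ proj j b n ]))
              (map-∘ (upTo n)) ⟨
    Cj._+ₛ_ j (proj j a) (proj j b) n ∎
    where
      open ≡-Reasoning
      terms = map (λ k → a (n ∸ sucℕ k) L.⊗ b k) (upTo n)

  -- Part 2: apply part 1 to a + b; the uniform bound comes from the bounds
  -- of a and b in L via `+ₛ-eventually-zero` in each component.
  sum-good-iff-componentwise : (a b : ℕ → L.Carrier) → L.Good a → L.Good b
    → L.Good (a L.+ₛ b) ⇔ (∀ j → Cj.Good j (Cj._+ₛ_ j (proj j a) (proj j b)))
  sum-good-iff-componentwise a b (_ , rₐ , a-vanish) (_ , r_b , b-vanish) = mk⇔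
    (λ good j → Good-resp-≗ (Cj.ops j) (π-+ₛ j a b) (proj₁ (to good) j))
    (λ good → from ((λ j → Good-resp-≗ (Cj.ops j) (λ n → sym (π-+ₛ j a b n)) (good j))
                   , rₐ + r_b , uniform-bound))
    where
      open Equivalence (good-iff-componentwise (a L.+ₛ b))
      uniform-bound : ∀ n → rₐ + r_b ≤ n → ∀ j → Cj._≈_ j (proj j (a L.+ₛ b) n) (Cj.𝟎 j)
      uniform-bound n bound j =
        subst (λ t → Cj._≈_ j t (Cj.𝟎 j)) (sym (π-+ₛ j a b n))
          (ZeroFacts.+ₛ-eventually-zero (C j) (proj j a) (proj j b)
             (λ m r≤m → a-vanish m r≤m j) (λ m r≤m → b-vanish m r≤m j) n bound)

lemma4p5 : ∀ {i c ℓ p : Level} {I : Set i} (C : I → BLAlgebra c ℓ)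
    → (∀ j → IsChain (C j))
    → (P : Π C → Set p) (S : IsSubdirectProduct C P)
    → let module L = BLOps (subOps C P S)
          module Cj (j : I) = BLAlgebra (C j)
          -- 𝐚ᵢ = (πᵢ(a₁), πᵢ(a₂), …)
          proj : (j : I) → (ℕ → L.Carrier) → ℕ → Cj.Carrier j
          proj j a n = proj₁ (a n) j
      in ((a : ℕ → L.Carrier)
           → L.Good a
             ⇔ ((∀ j → Cj.Good j (proj j a))
                × ∃ λ m → ∀ n → m ≤ n → ∀ j → Cj._≈_ j (proj j a n) (Cj.𝟎 j)))
         × ((a b : ℕ → L.Carrier) → L.Good a → L.Good b
           → L.Good (a L.+ₛ b)
             ⇔ (∀ j → Cj.Good j (Cj._+ₛ_ j (proj j a) (proj j b))))
lemma4p5 C _ P S =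
  good-iff-componentwise , sum-good-iff-componentwise
  where open SubdirectSequences C P S
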